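{- Let $\mathcal{H}(n,3,3)$ be the 3-uniform hypergraph with vertex set $[n]^3$ whose edges are all collinear triples of points of $[n]^3$ (three points on a common line of $\mathbb{R}^3$). Let $0\le s<1$. Then for $n$ sufficiently large, every set of $n^{3-s}$ vertices of $\mathcal{H}(n,3,3)$ spans at least $\frac{n^{6-4s}}{3\cdot 10^9\log n}$ hyperedges.
   Context: $[n]=\{1,\dots,n\}$; logarithms are to base 2; a set of vertices spans a hyperedge if it contains all vertices of that hyperedge. -}

module Defs where

open import Data.Nat using (ℕ; suc; _+_; _*_; _^_; _≤_; _<_)
open import Data.Integer as ℤ using (ℤ; +_; _-_)
open import Data.Rational as ℚ using (ℚ; _/_)
open import Data.Fin using (Fin; toℕ)
open import Data.Product using (_×_; _,_; ∃-syntax)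
open import Data.Sum using (_⊎_)
open import Data.Bool using (Bool; true; false; _∧_; if_then_else_)
open import Data.List using (List; []; _∷_; length)
open import Relation.Nullary using (¬_)

-- Real numbers as Dedekind cuts of ℚ (no reals in agda-stdlib).
-- L q  means  q < x ;  U q  means  x < q.

record ℝ : Set₁ where
  field
    L U        : ℚ → Set
    inhabitedL : ∃[ q ] L q
    inhabitedU : ∃[ q ] U q
    roundedL₁  : ∀ q → L q → ∃[ r ] (q ℚ.< r × L r)
    roundedL₂  : ∀ q r → q ℚ.< r → L r → L q
    roundedU₁  : ∀ q → U q → ∃[ r ] (r ℚ.< q × U r)
    roundedU₂  : ∀ q r → r ℚ.< q → U r → U q
    disjoint   : ∀ q → ¬ (L q × U q)
    located    : ∀ q r → q ℚ.< r → L q ⊎ U r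

open ℝ public

_<ʳ_ : ℝ → ℚ → Set
x <ʳ q = U x q

-- The hypergraph H(n,3,3).  Vertices: [n]^3, coordinates shifted to
-- {0,…,n-1} (collinearity is translation invariant).

Point : ℕ → Set
Point n = Fin n × Fin n × Fin n

coords : ∀ {n} → Point n → ℤ × ℤ × ℤ
coords (a , b , c) = (+ toℕ a , + toℕ b , + toℕ c)

isZero : ℤ → Bool
isZero (+ 0) = true
isZero _     = false

-- p, q, r lie on a common line of ℝ³  iff  (q - p) × (r - p) = 0
collinear : ∀ {n} → Point n → Point n → Point n → Bool
collinear p q r with coords p | coords q | coords r
... | (p1 , p2 , p3) | (q1 , q2 , q3) | (r1 , r2 , r3) =
  let u1 = q1 - p1 ; u2 = q2 - p2 ; u3 = q3 - p3
      v1 = r1 - p1 ; v2 = r2 - p2 ; v3 = r3 - p3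
  in isZero (u2 ℤ.* v3 - u3 ℤ.* v2)
     ∧ isZero (u3 ℤ.* v1 - u1 ℤ.* v3)
     ∧ isZero (u1 ℤ.* v2 - u2 ℤ.* v1)

-- Number of hyperedges spanned by the vertex list S (S duplicate-free):
-- number of 3-element sublists {x,y,z} (positions i<j<k) that are collinear.
private
  count2 : ∀ {n} → Point n → Point n → List (Point n) → ℕ
  count2 x y []      = 0
  count2 x y (z ∷ zs) = (if collinear x y z then 1 else 0) + count2 x y zs

  count1 : ∀ {n} → Point n → List (Point n) → ℕ
  count1 x []       = 0
  count1 x (y ∷ ys) = count2 x y ys + count1 x ys

spanned : ∀ {n} → List (Point n) → ℕ
spanned []       = 0
spanned (x ∷ xs) = count1 x xs + spanned xs

-- Real-exponent inequalities, expressed through rational approximations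
-- (valid for n ≥ 2 by continuity/monotonicity of t ↦ n^t and of log).

-- m ≥ n^(3 - s):  for every rational a/b (a ≥ 0, b ≥ 1) with a/b < 3 - s,
-- i.e. s < (3b - a)/b, we have n^(a/b) ≤ m, i.e. n^a ≤ m^b.
AtLeastPow3 : ℕ → ℝ → ℕ → Set
AtLeastPow3 n s m =
  ∀ (a b' : ℕ) → let b = suc b' in
    s <ʳ ((+ (3 * b) - + a) / b) → n ^ a ≤ m ^ b

C : ℕ
C = 3 * 10 ^ 9

-- E ≥ n^(6 - 4s) / (C · log₂ n), i.e. n^(6-4s)/(C·E) ≤ log₂ n:
-- for every rational a/b < 6 - 4s (a ≥ 0, b ≥ 1), i.e. s < (6b - a)/(4b),
-- and every rational c/d (c ≥ 0, d ≥ 1) with c/d < n^(a/b)/(C·E),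
-- i.e. (c·C·E)^b < d^b·n^a, we have c/d ≤ log₂ n, i.e. 2^c ≤ n^d.
EdgeBound : ℕ → ℝ → ℕ → Set
EdgeBound n s E =
  ∀ (a b' c d' : ℕ) → let b = suc b' ; d = suc d' in
    s <ʳ ((+ (6 * b) - + a) / (4 * b)) →
    (c * C * E) ^ b < d ^ b * n ^ a →
    2 ^ c ≤ n ^ d

module Submission where

-- We prove the stronger, logarithm-free bound E ≥ m⁴/(2²⁰n⁶) by double counting collinear
-- triples along lattice directions.  For n ≥ 32^q, where s < p/q < 1, we have m ≥ 32n², so
-- 32Tn² ≤ m < 64Tn² for some T = 2^J.  Consider the T³ directions (t, b, c) of the box
-- t ∈ [T, 2T), b, c ∈ [0, T):
--   • at least half of them are primitive, by a dyadic union bound over common divisors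
--     k ≥ 2 (`primitive-many`);
--   • for each direction the lines meeting [n]³ are separated by a key with fewer than 8Tn²
--     values (`LineKey`), so all but 16Tn² ≤ m/2 points of S start a triple on a common
--     line (`Colouring.monochromatic-bound`);
--   • points on a common line are collinear, and two distinct points lie on a common line of
--     at most one primitive direction, so every collinear triple is counted at most once.
-- This gives T³m ≤ 4E and hence m⁴ ≤ 2²⁰n⁶E (`Counting`).  The file develops finite sums,
-- the divisor count, monochromatic triples and the line geometry in this order, and ends with
-- the translation of the real-exponent statement (`edgeBound-from`, `lemma4p2`).

open import Defs
open import Data.Nat
open import Data.Nat.Properties
open import Data.Nat.Divisibility using (_∣_; _∣?_; ∣-trans; ∣⇒≤; ∣m+n∣m⇒∣n; ∣-antisym; m∣m*n; 0∣⇒≡0)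
open import Data.Nat.DivMod using (m%n<n; m≡m%n+[m/n]*n; m/n*n≤m; /-monoˡ-≤; [m+kn]%n≡m%n; m<n⇒m%n≡m)
open import Data.Nat.GCD using (gcd; gcd[m,n]∣m; gcd[m,n]∣n; gcd-greatest; c*gcd[m,n]≡gcd[cm,cn])
open import Data.Nat.Tactic.RingSolver using (solve-∀)
import Data.Integer as ℤ
import Data.Integer.Properties as ℤP
import Data.Integer.Tactic.RingSolver as ℤ-Ring
open import Data.Rational as ℚ using (ℚ; mkℚ; 0ℚ; 1ℚ)
import Data.Rational.Properties as ℚP
open import Data.Fin using (toℕ)
open import Data.Fin.Properties using (toℕ<n; toℕ-injective)
open import Data.Bool using (Bool; true; false; _∧_; if_then_else_)
open import Data.Product using (_×_; _,_; ∃-syntax; proj₁; proj₂)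
open import Data.Sum using (_⊎_; inj₁; inj₂)
open import Data.List using (List; []; _∷_; length)
open import Data.List.Relation.Unary.All using (All; []; _∷_; tabulate)
open import Data.List.Relation.Unary.AllPairs using ([]; _∷_)
open import Data.List.Relation.Unary.Unique.Propositional using (Unique)
open import Data.Empty using (⊥; ⊥-elim)
open import Relation.Nullary using (¬_; Dec; yes; no)
open import Relation.Nullary.Decidable using (¬?)
open import Relation.Binary.PropositionalEquality
open import Relation.Binary.Definitions using (tri<; tri≈; tri>)

sum : ℕ → (ℕ → ℕ) → ℕ
sum zero    f = 0
sum (suc n) f = sum n f + f n

sum-cong : ∀ n {f g : ℕ → ℕ} → (∀ i → i < n → f i ≡ g i) → sum n f ≡ sum n g
sum-cong zero    h = refl
sum-cong (suc n) h = cong₂ _+_ (sum-cong n (λ i i<n → h i (m<n⇒m<1+n i<n))) (h n ≤-refl)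

sum-mono : ∀ n {f g : ℕ → ℕ} → (∀ i → i < n → f i ≤ g i) → sum n f ≤ sum n g
sum-mono zero    h = z≤n
sum-mono (suc n) h = +-mono-≤ (sum-mono n (λ i i<n → h i (m<n⇒m<1+n i<n))) (h n ≤-refl)

sum-const : ∀ n k → sum n (λ _ → k) ≡ n * k
sum-const zero    k = refl
sum-const (suc n) k = trans (cong (_+ k) (sum-const n k)) (+-comm (n * k) k)

sum-+ : ∀ n (f g : ℕ → ℕ) → sum n (λ i → f i + g i) ≡ sum n f + sum n g
sum-+ zero    f g = refl
sum-+ (suc n) f g = trans (cong (_+ (f n + g n)) (sum-+ n f g)) (+-interchange (sum n f) _ _ _)
  where
  +-interchange : ∀ a b c d → a + b + (c + d) ≡ a + c + (b + d)
  +-interchange = solve-∀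

sum-*ˡ : ∀ n k (f : ℕ → ℕ) → sum n (λ i → k * f i) ≡ k * sum n f
sum-*ˡ zero    k f = sym (*-zeroʳ k)
sum-*ˡ (suc n) k f = trans (cong (_+ k * f n) (sum-*ˡ n k f)) (sym (*-distribˡ-+ k (sum n f) (f n)))

sum-*ʳ : ∀ n k (f : ℕ → ℕ) → sum n (λ i → f i * k) ≡ sum n f * k
sum-*ʳ n k f = trans (sum-cong n (λ i _ → *-comm (f i) k)) (trans (sum-*ˡ n k f) (*-comm k (sum n f)))

sum-swap : ∀ n m (f : ℕ → ℕ → ℕ) →
  sum n (λ i → sum m (λ j → f i j)) ≡ sum m (λ j → sum n (λ i → f i j))
sum-swap zero    m f = sym (trans (sum-const m 0) (*-zeroʳ m))
sum-swap (suc n) m f = trans (cong (_+ sum m (f n)) (sum-swap n m f))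
                             (sym (sum-+ m (λ j → sum n (λ i → f i j)) (f n)))

sum-split : ∀ a b (f : ℕ → ℕ) → sum (a + b) f ≡ sum a f + sum b (λ i → f (a + i))
sum-split a zero    f = trans (cong (λ z → sum z f) (+-identityʳ a)) (sym (+-identityʳ _))
sum-split a (suc b) f = begin
  sum (a + suc b) f                            ≡⟨ cong (λ z → sum z f) (+-suc a b) ⟩
  sum (a + b) f + f (a + b)                    ≡⟨ cong (_+ f (a + b)) (sum-split a b f) ⟩
  sum a f + sum b (λ i → f (a + i)) + f (a + b) ≡⟨ +-assoc (sum a f) _ _ ⟩
  sum a f + sum (suc b) (λ i → f (a + i))       ∎
  where open ≡-Reasoning

sum-single : ∀ n (f : ℕ → ℕ) i → i < n → f i ≤ sum n f
sum-single zero    f i ()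
sum-single (suc n) f i i<1+n with m≤n⇒m<n∨m≡n (≤-pred i<1+n)
... | inj₁ i<n  = ≤-trans (sum-single n f i i<n) (m≤m+n _ _)
... | inj₂ refl = m≤n+m _ _

sum-pos : ∀ n (f : ℕ → ℕ) → 1 ≤ sum n f → ∃[ i ] (i < n × 1 ≤ f i)
sum-pos zero    f ()
sum-pos (suc n) f h with f n in eq
... | suc _ = n , ≤-refl , subst (1 ≤_) (sym eq) (s≤s z≤n)
... | zero with sum-pos n f (subst (1 ≤_) (+-identityʳ (sum n f)) h)
...   | i , i<n , fi = i , m<n⇒m<1+n i<n , fi

sum≤1 : ∀ n (f : ℕ → ℕ) → (∀ i → i < n → f i ≤ 1) →
  (∀ i j → i < n → j < n → 1 ≤ f i → 1 ≤ f j → i ≡ j) → sum n f ≤ 1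
sum≤1 zero    f bounded unique = z≤n
sum≤1 (suc n) f bounded unique with f n in eq
... | zero  = subst (_≤ 1) (sym (+-identityʳ _))
                (sum≤1 n f (λ i i<n → bounded i (m<n⇒m<1+n i<n))
                  (λ i j i<n j<n → unique i j (m<n⇒m<1+n i<n) (m<n⇒m<1+n j<n)))
... | suc k = begin
  sum n f + suc k ≡⟨ cong₂ _+_ rest-zero last≡1 ⟩
  1               ∎
  where
  open ≤-Reasoning
  last≡1 : suc k ≡ 1
  last≡1 = ≤-antisym (subst (_≤ 1) eq (bounded n ≤-refl)) (s≤s z≤n)
  rest-zero : sum n f ≡ 0
  rest-zero = n≤0⇒n≡0 (≮⇒≥ λ pos →
    let (i , i<n , fi) = sum-pos n f pos
    in <-irrefl (unique i n (m<n⇒m<1+n i<n) ≤-refl fi (subst (1 ≤_) (sym eq) (s≤s z≤n))) i<n)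

sum²-pos : ∀ n m (f : ℕ → ℕ → ℕ) → 1 ≤ sum n (λ i → sum m (f i)) → ∃[ i ] ∃[ j ] (i < n × j < m × 1 ≤ f i j)
sum²-pos n m f pos with sum-pos n _ pos
... | i , i<n , row-pos with sum-pos m (f i) row-pos
... | j , j<m , fij = i , j , i<n , j<m , fij

sum²≤1 : ∀ n m (f : ℕ → ℕ → ℕ) → (∀ i j → i < n → j < m → f i j ≤ 1) →
  (∀ i j i′ j′ → i < n → j < m → i′ < n → j′ < m → 1 ≤ f i j → 1 ≤ f i′ j′ → i ≡ i′ × j ≡ j′) →
  sum n (λ i → sum m (f i)) ≤ 1
sum²≤1 n m f bounded unique = sum≤1 n _ row≤1 row-unique
  where
  row≤1 : ∀ i → i < n → sum m (f i) ≤ 1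
  row≤1 i i<n = sum≤1 m (f i) (λ j j<m → bounded i j i<n j<m)
                  (λ j j′ j<m j′<m p p′ → proj₂ (unique i j i j′ i<n j<m i<n j′<m p p′))
  row-unique : ∀ i i′ → i < n → i′ < n → 1 ≤ sum m (f i) → 1 ≤ sum m (f i′) → i ≡ i′
  row-unique i i′ i<n i′<n p p′ with sum-pos m (f i) p | sum-pos m (f i′) p′
  ... | j , j<m , q | j′ , j′<m , q′ = proj₁ (unique i j i′ j′ i<n j<m i′<n j′<m q q′)

sum-update : ∀ n a (f f′ : ℕ → ℕ) → a < n → (∀ c → c < n → c ≢ a → f c ≡ f′ c) →
  sum n f + f′ a ≡ sum n f′ + f a
sum-update zero    a f f′ () agree
sum-update (suc n) a f f′ a<1+n agree with a ≟ n
... | yes refl = begin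
  sum a f + f a + f′ a  ≡⟨ cong (λ z → z + f a + f′ a) (sum-cong a (λ c c<a → agree c (m<n⇒m<1+n c<a) (<⇒≢ c<a))) ⟩
  sum a f′ + f a + f′ a ≡⟨ swap (sum a f′) (f a) (f′ a) ⟩
  sum a f′ + f′ a + f a ∎
  where
  open ≡-Reasoning
  swap : ∀ x y z → x + y + z ≡ x + z + y
  swap = solve-∀
... | no a≢n = begin
  sum n f + f n + f′ a  ≡⟨ swap (sum n f) (f n) (f′ a) ⟩
  sum n f + f′ a + f n  ≡⟨ cong₂ _+_ (sum-update n a f f′ a<n (λ c c<n → agree c (m<n⇒m<1+n c<n))) (agree n ≤-refl (≢-sym a≢n)) ⟩
  sum n f′ + f a + f′ n ≡⟨ swap (sum n f′) (f a) (f′ n) ⟩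
  sum n f′ + f′ n + f a ∎
  where
  open ≡-Reasoning
  a<n : a < n
  a<n = ≤∧≢⇒< (≤-pred a<1+n) a≢n
  swap : ∀ x y z → x + y + z ≡ x + z + y
  swap = solve-∀

𝟙[_] : ∀ {p} {P : Set p} → Dec P → ℕ
𝟙[ yes _ ] = 1
𝟙[ no _  ] = 0

𝟙≤1 : ∀ {p} {P : Set p} (d : Dec P) → 𝟙[ d ] ≤ 1
𝟙≤1 (yes _) = ≤-refl
𝟙≤1 (no _)  = z≤n

𝟙-true : ∀ {p} {P : Set p} (d : Dec P) → P → 𝟙[ d ] ≡ 1
𝟙-true (yes _) _  = refl
𝟙-true (no ¬p) p = ⊥-elim (¬p p)

𝟙-intro : ∀ {p} {P : Set p} (d : Dec P) → P → 1 ≤ 𝟙[ d ]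
𝟙-intro d p = ≤-reflexive (sym (𝟙-true d p))

𝟙-elim : ∀ {p} {P : Set p} (d : Dec P) → 1 ≤ 𝟙[ d ] → P
𝟙-elim (yes p) _ = p
𝟙-elim (no _)  ()

1≤*-split : ∀ a b → 1 ≤ a * b → 1 ≤ a × 1 ≤ b
1≤*-split zero    b ()
1≤*-split (suc a) (suc b) _ = s≤s z≤n , s≤s z≤n
1≤*-split (suc a) zero h = ⊥-elim (<-irrefl refl (≤-trans h (≤-reflexive (*-zeroʳ a))))

multiples : ℕ → ℕ → ℕ → ℕ
multiples a len k = sum len (λ i → 𝟙[ k ∣? a + i ])

multiples-short : ∀ a len k → len ≤ k → multiples a len k ≤ 1
multiples-short a len k len≤k = sum≤1 len _ (λ i _ → 𝟙≤1 _) unique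
  where
  -- two multiples a + i < a + j of k differ by a positive multiple of k, hence by at least k
  apart : ∀ i j → j < k → k ∣ a + i → k ∣ a + j → i < j → ⊥
  apart i j j<k k∣i k∣j i<j = <-irrefl refl (<-≤-trans gap<k (∣⇒≤ {{>-nonZero (m<n⇒0<n∸m i<j)}} k∣gap))
    where
    gap<k : j ∸ i < k
    gap<k = ≤-<-trans (m∸n≤m j i) j<k
    k∣gap : k ∣ j ∸ i
    k∣gap = ∣m+n∣m⇒∣n (subst (k ∣_) (trans (cong (a +_) (sym (m+[n∸m]≡n (<⇒≤ i<j)))) (sym (+-assoc a i _))) k∣j) k∣i
  unique : ∀ i j → i < len → j < len → 1 ≤ 𝟙[ k ∣? a + i ] → 1 ≤ 𝟙[ k ∣? a + j ] → i ≡ j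
  unique i j i<len j<len mi mj with <-cmp i j
  ... | tri< i<j _ _ = ⊥-elim (apart i j (<-≤-trans j<len len≤k) (𝟙-elim _ mi) (𝟙-elim _ mj) i<j)
  ... | tri≈ _ i≡j _ = i≡j
  ... | tri> _ _ j<i = ⊥-elim (apart j i (<-≤-trans i<len len≤k) (𝟙-elim _ mj) (𝟙-elim _ mi) j<i)

multiples-bound : ∀ q a len k → len ≤ q * k → multiples a len k ≤ q
multiples-bound zero a len k len≤0 with n≤0⇒n≡0 len≤0
... | refl = z≤n
multiples-bound (suc q) a len k len≤ with len ≤? k
... | yes len≤k = ≤-trans (multiples-short a len k len≤k) (s≤s z≤n)
... | no  len≰k = begin
  multiples a len k                                 ≡⟨ cong (λ l → sum l _) (sym (m+[n∸m]≡n k≤len)) ⟩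
  sum (k + rest) (λ i → 𝟙[ k ∣? a + i ])            ≡⟨ sum-split k rest _ ⟩
  multiples a k k + sum rest (λ i → 𝟙[ k ∣? a + (k + i) ])
      ≡⟨ cong (multiples a k k +_) (sum-cong rest (λ i _ → cong (λ x → 𝟙[ k ∣? x ]) (sym (+-assoc a k i)))) ⟩
  multiples a k k + multiples (a + k) rest k         ≤⟨ +-mono-≤ (multiples-short a k k ≤-refl) (multiples-bound q (a + k) rest k rest≤) ⟩
  suc q                                             ∎
  where
  open ≤-Reasoning
  k≤len : k ≤ len
  k≤len = <⇒≤ (≰⇒> len≰k)
  rest : ℕ
  rest = len ∸ k
  rest≤ : rest ≤ q * k
  rest≤ = subst (rest ≤_) (m+n∸m≡n k (q * k)) (∸-monoˡ-≤ k len≤)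

primitive? : ∀ t b c → Dec (gcd t (gcd b c) ≡ 1)
primitive? t b c = gcd t (gcd b c) ≟ 1

isPrimitive isImprimitive : ℕ → ℕ → ℕ → ℕ
isPrimitive   t b c = 𝟙[ primitive? t b c ]
isImprimitive t b c = 𝟙[ ¬? (primitive? t b c) ]

directionSum : ℕ → (ℕ → ℕ → ℕ → ℕ) → ℕ
directionSum T h = sum T (λ i → sum T (λ b → sum T (λ c → h (T + i) b c)))

directionSum-mono : ∀ T {h h′ : ℕ → ℕ → ℕ → ℕ} →
  (∀ i b c → i < T → b < T → c < T → h (T + i) b c ≤ h′ (T + i) b c) →
  directionSum T h ≤ directionSum T h′
directionSum-mono T h≤h′ =
  sum-mono T (λ i i< → sum-mono T (λ b b< → sum-mono T (λ c c< → h≤h′ i b c i< b< c<)))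

directionSum-*ˡ : ∀ T k (h : ℕ → ℕ → ℕ → ℕ) → directionSum T (λ t b c → k * h t b c) ≡ k * directionSum T h
directionSum-*ˡ T k h =
  trans (sum-cong T (λ i _ → trans (sum-cong T (λ b _ → sum-*ˡ T k _)) (sum-*ˡ T k _))) (sum-*ˡ T k _)

directionSum-*ʳ : ∀ T k (h : ℕ → ℕ → ℕ → ℕ) → directionSum T (λ t b c → h t b c * k) ≡ directionSum T h * k
directionSum-*ʳ T k h =
  trans (sum-cong T (λ i _ → trans (sum-cong T (λ b _ → sum-*ʳ T k _)) (sum-*ʳ T k _))) (sum-*ʳ T k _)

directionSum-split : ∀ T →
  directionSum T isPrimitive + directionSum T isImprimitive ≡ T * T * T
directionSum-split T = begin
  directionSum T isPrimitive + directionSum T isImprimitive                ≡⟨ sym (sum-+ T _ _) ⟩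
  sum T (λ i → sum T (λ b → sum T (λ c → isPrimitive (T + i) b c)) + sum T (λ b → sum T (λ c → isImprimitive (T + i) b c)))
    ≡⟨ sum-cong T (λ i _ → trans (sym (sum-+ T _ _)) (sum-cong T (λ b _ →
         trans (sym (sum-+ T _ _)) (sum-cong T (λ c _ → either (T + i) b c))))) ⟩
  sum T (λ i → sum T (λ b → sum T (λ c → 1)))                   ≡⟨ sum-cong T (λ i _ → trans (sum-cong T (λ b _ → sum-const T 1)) (sum-const T (T * 1))) ⟩
  sum T (λ i → T * (T * 1))                                     ≡⟨ sum-const T _ ⟩
  T * (T * (T * 1))                                             ≡⟨ cube T ⟩
  T * T * T                                                     ∎
  where
  open ≡-Reasoning
  either : ∀ t b c → isPrimitive t b c + isImprimitive t b c ≡ 1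
  either t b c with primitive? t b c
  ... | yes _ = refl
  ... | no _  = refl
  cube : ∀ t → t * (t * (t * 1)) ≡ t * t * t
  cube = solve-∀

module _ (T : ℕ) where

  divisorCount : ℕ → ℕ
  divisorCount k = 𝟙[ 2 ≤? k ] * (multiples T T k * (multiples 0 T k * multiples 0 T k))

  divisorCount-bound : ∀ X k → T ≤ X * k → divisorCount k ≤ X * (X * X)
  divisorCount-bound X k T≤Xk = begin
    𝟙[ 2 ≤? k ] * M                ≤⟨ *-monoˡ-≤ M (𝟙≤1 (2 ≤? k)) ⟩
    M + 0                          ≡⟨ +-identityʳ M ⟩
    M                              ≤⟨ *-mono-≤ (bound T) (*-mono-≤ (bound 0) (bound 0)) ⟩
    X * (X * X)                    ∎
    where
    open ≤-Reasoning
    M : ℕ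
    M = multiples T T k * (multiples 0 T k * multiples 0 T k)
    bound : ∀ a → multiples a T k ≤ X
    bound a = multiples-bound X a T k T≤Xk

  divisorSum : ℕ → ℕ
  divisorSum a = sum (2 * a) divisorCount

  -- Dyadic invariant: Σ_{k<2a} divisorCount k ≤ T³ (1 - 1/a²) / 3.
  DyadicBound : ℕ → Set
  DyadicBound a = 3 * (a * a) * divisorSum a + T * T * T ≤ T * T * T * (a * a)

  dyadic-base : DyadicBound 1
  dyadic-base = ≤-reflexive (sym (*-identityʳ (T * T * T)))

  -- Passing from a to 2a adds the block k ∈ [2a, 4a), where each k has at most
  -- X = T/(2a) multiples in each coordinate range, costing at most 2a·X³ = T³/(2a)².
  dyadic-step : ∀ a X → 2 * a * X ≡ T → DyadicBound a → DyadicBound (2 * a)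
  dyadic-step a X 2aX≡T IH = +-cancelʳ-≤ (3 * TTT) _ _ (begin
    3 * (P * P) * divisorSum P + TTT + 3 * TTT   ≡⟨ cong (λ z → 3 * (P * P) * z + TTT + 3 * TTT) split ⟩
    3 * (P * P) * (divisorSum a + B) + TTT + 3 * TTT ≡⟨ regroup (divisorSum a) B a TTT ⟩
    4 * (3 * (a * a) * divisorSum a + TTT) + 3 * (P * P) * B
        ≤⟨ +-mono-≤ (*-monoʳ-≤ 4 IH) (*-monoʳ-≤ (3 * (P * P)) block) ⟩
    4 * (TTT * (a * a)) + 3 * (P * P) * (P * (X * (X * X))) ≡⟨ cong (4 * (TTT * (a * a)) +_) cubeT ⟩
    4 * (TTT * (a * a)) + 3 * TTT                 ≡⟨ quadruple TTT a ⟩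
    TTT * (P * P) + 3 * TTT                       ∎)
    where
    open ≤-Reasoning
    TTT P B : ℕ
    TTT = T * T * T
    P = 2 * a
    B = sum P (λ i → divisorCount (P + i))
    split : divisorSum P ≡ divisorSum a + B
    split = trans (cong (λ z → sum z divisorCount) (cong (P +_) (+-identityʳ P))) (sum-split P P divisorCount)
    block : B ≤ P * (X * (X * X))
    block = ≤-trans (sum-mono P (λ i _ → divisorCount-bound X (P + i)
                      (subst (_≤ X * (P + i)) (trans (*-comm X P) 2aX≡T) (*-monoʳ-≤ X (m≤m+n P i)))))
                    (≤-reflexive (sum-const P _))
    regroup : ∀ d b a t → 3 * ((2 * a) * (2 * a)) * (d + b) + t + 3 * t ≡ 4 * (3 * (a * a) * d + t) + 3 * ((2 * a) * (2 * a)) * b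
    regroup = solve-∀
    cubeT : 3 * (P * P) * (P * (X * (X * X))) ≡ 3 * TTT
    cubeT = trans (cubes P X) (cong (λ z → 3 * (z * z * z)) 2aX≡T)
      where
      cubes : ∀ p x → 3 * (p * p) * (p * (x * (x * x))) ≡ 3 * ((p * x) * (p * x) * (p * x))
      cubes = solve-∀
    quadruple : ∀ t a → 4 * (t * (a * a)) + 3 * t ≡ t * ((2 * a) * (2 * a)) + 3 * t
    quadruple = solve-∀

  dyadic : ∀ j e → 2 ^ (j + e) ≡ T → DyadicBound (2 ^ j)
  dyadic zero    e _   = dyadic-base
  dyadic (suc j) e 2ʲ⁺ᵉ≡T = dyadic-step (2 ^ j) (2 ^ e) (trans (sym (^-distribˡ-+-* 2 (suc j) e)) 2ʲ⁺ᵉ≡T)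
                              (dyadic j (suc e) (trans (cong (2 ^_) (+-suc j e)) 2ʲ⁺ᵉ≡T))

divisorSum-bound : ∀ J → let T = 2 ^ J in 3 * divisorSum T T ≤ T * T * T
divisorSum-bound J = *-cancelʳ-≤ (3 * D) (T * T * T) (T * T) {{T²≢0}} (begin
  3 * D * (T * T)                  ≡⟨ swap 3 D (T * T) ⟩
  3 * (T * T) * D                  ≤⟨ m≤m+n _ _ ⟩
  3 * (T * T) * D + T * T * T      ≤⟨ dyadic T J 0 (cong (2 ^_) (+-identityʳ J)) ⟩
  T * T * T * (T * T)              ∎)
  where
  open ≤-Reasoning
  T D : ℕ
  T = 2 ^ J
  D = divisorSum T T
  T²≢0 : NonZero (T * T)
  T²≢0 = >-nonZero (*-mono-≤ (m^n>0 2 J) (m^n>0 2 J))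
  swap : ∀ a b c → a * b * c ≡ a * c * b
  swap = solve-∀

commonDivisor : ℕ → ℕ → ℕ → ℕ → ℕ
commonDivisor k t b c = 𝟙[ 2 ≤? k ] * (𝟙[ k ∣? t ] * (𝟙[ k ∣? b ] * 𝟙[ k ∣? c ]))

-- A non-primitive direction with 0 < t < 2T has the common divisor g = gcd(t,b,c) ∈ [2, 2T).
nonPrimitive-divisor : ∀ T t b c → 1 ≤ t → t < 2 * T →
  isImprimitive t b c ≤ sum (2 * T) (λ k → commonDivisor k t b c)
nonPrimitive-divisor T t b c 1≤t t<2T with primitive? t b c
... | yes _ = z≤n
... | no g≢1 = ≤-trans g-counts (sum-single (2 * T) (λ k → commonDivisor k t b c) g (≤-<-trans g≤t t<2T))
  where
  g : ℕ
  g = gcd t (gcd b c)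
  g∣t : g ∣ t
  g∣t = gcd[m,n]∣m t (gcd b c)
  g∣b : g ∣ b
  g∣b = ∣-trans (gcd[m,n]∣n t (gcd b c)) (gcd[m,n]∣m b c)
  g∣c : g ∣ c
  g∣c = ∣-trans (gcd[m,n]∣n t (gcd b c)) (gcd[m,n]∣n b c)
  g≤t : g ≤ t
  g≤t = ∣⇒≤ {{>-nonZero 1≤t}} g∣t
  atLeast2 : ∀ d → d ∣ t → d ≢ 1 → 2 ≤ d
  atLeast2 zero          0∣t _  = ⊥-elim (<-irrefl (sym (0∣⇒≡0 0∣t)) 1≤t)
  atLeast2 (suc zero)    _   ≢1 = ⊥-elim (≢1 refl)
  atLeast2 (suc (suc _)) _   _  = s≤s (s≤s z≤n)
  2≤g : 2 ≤ g
  2≤g = atLeast2 g g∣t g≢1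
  g-counts : 1 ≤ commonDivisor g t b c
  g-counts = *-mono-≤ (𝟙-intro (2 ≤? g) 2≤g)
               (*-mono-≤ (𝟙-intro (g ∣? t) g∣t) (*-mono-≤ (𝟙-intro (g ∣? b) g∣b) (𝟙-intro (g ∣? c) g∣c)))

sum-factorise : ∀ n m x (f g : ℕ → ℕ) →
  sum n (λ i → sum m (λ b → sum m (λ c → x * (f i * (g b * g c))))) ≡ x * (sum n f * (sum m g * sum m g))
sum-factorise n m x f g = begin
  sum n (λ i → sum m (λ b → sum m (λ c → x * (f i * (g b * g c)))))
    ≡⟨ sum-cong n (λ i _ → sum-cong m (λ b _ → trans (sum-cong m (λ c _ → assoc x (f i) (g b) (g c))) (sum-*ˡ m (x * (f i * g b)) g))) ⟩
  sum n (λ i → sum m (λ b → x * (f i * g b) * sum m g))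
    ≡⟨ sum-cong n (λ i _ → trans (sum-*ʳ m (sum m g) _)
         (cong (_* sum m g) (trans (sum-cong m (λ b _ → sym (*-assoc x (f i) (g b)))) (sum-*ˡ m (x * f i) g)))) ⟩
  sum n (λ i → x * f i * sum m g * sum m g)
    ≡⟨ trans (sum-*ʳ n (sum m g) _) (cong (_* sum m g) (trans (sum-*ʳ n (sum m g) _) (cong (_* sum m g) (sum-*ˡ n x f)))) ⟩
  x * sum n f * sum m g * sum m g ≡⟨ reassoc x (sum n f) (sum m g) ⟩
  x * (sum n f * (sum m g * sum m g)) ∎
  where
  open ≡-Reasoning
  assoc : ∀ x a b c → x * (a * (b * c)) ≡ x * (a * b) * c
  assoc = solve-∀
  reassoc : ∀ x a b → x * a * b * b ≡ x * (a * (b * b))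
  reassoc = solve-∀

-- Union bound: every non-primitive direction of the box is divisible by some k ∈ [2, 2T).
nonPrimitive-count : ∀ T → 1 ≤ T → directionSum T isImprimitive ≤ divisorSum T T
nonPrimitive-count T 1≤T = begin
  directionSum T isImprimitive
    ≤⟨ directionSum-mono T {isImprimitive} {λ t b c → sum (2 * T) (λ k → commonDivisor k t b c)} (λ i b c i<T _ _ → nonPrimitive-divisor T (T + i) b c
         (≤-trans 1≤T (m≤m+n T i)) (subst (T + i <_) (cong (T +_) (sym (+-identityʳ T))) (+-monoʳ-< T i<T))) ⟩
  sum T (λ i → sum T (λ b → sum T (λ c → sum (2 * T) (λ k → commonDivisor k (T + i) b c))))
    ≡⟨ sum-cong T (λ i _ → trans (sum-cong T (λ b _ → sum-swap T (2 * T) _)) (sum-swap T (2 * T) _)) ⟩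
  sum T (λ i → sum (2 * T) (λ k → sum T (λ b → sum T (λ c → commonDivisor k (T + i) b c))))
    ≡⟨ sum-swap T (2 * T) _ ⟩
  sum (2 * T) (λ k → sum T (λ i → sum T (λ b → sum T (λ c → commonDivisor k (T + i) b c))))
    ≡⟨ sum-cong (2 * T) (λ k _ → sum-factorise T T 𝟙[ 2 ≤? k ] (λ i → 𝟙[ k ∣? T + i ]) (λ b → 𝟙[ k ∣? b ])) ⟩
  divisorSum T T ∎
  where open ≤-Reasoning

primitive-many : ∀ J → let T = 2 ^ J in T * T * T ≤ 2 * directionSum T isPrimitive
primitive-many J = *-cancelˡ-≤ 2 (begin
  2 * TTT         ≤⟨ +-cancelʳ-≤ TTT _ _ (begin
    2 * TTT + TTT     ≡⟨ thrice TTT ⟩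
    3 * TTT           ≡⟨ cong (3 *_) (sym (directionSum-split T)) ⟩
    3 * (P + N)       ≡⟨ *-distribˡ-+ 3 P N ⟩
    3 * P + 3 * N     ≤⟨ +-monoʳ-≤ (3 * P) few ⟩
    3 * P + TTT       ∎) ⟩
  3 * P           ≤⟨ *-monoˡ-≤ P {3} {4} (s≤s (s≤s (s≤s z≤n))) ⟩
  4 * P           ≡⟨ *-assoc 2 2 P ⟩
  2 * (2 * P)     ∎)
  where
  open ≤-Reasoning
  T TTT P N : ℕ
  T = 2 ^ J
  TTT = T * T * T
  P = directionSum T isPrimitive
  N = directionSum T isImprimitive
  few : 3 * N ≤ TTT
  few = ≤-trans (*-monoʳ-≤ 3 (nonPrimitive-count T (m^n>0 2 J))) (divisorSum-bound J)
  thrice : ∀ x → 2 * x + x ≡ 3 * x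
  thrice = solve-∀

module _ {A : Set} where

  pairsAfter : (A → A → A → ℕ) → A → A → List A → ℕ
  pairsAfter f x y []       = 0
  pairsAfter f x y (z ∷ zs) = f x y z + pairsAfter f x y zs

  triplesFrom : (A → A → A → ℕ) → A → List A → ℕ
  triplesFrom f x []       = 0
  triplesFrom f x (y ∷ ys) = pairsAfter f x y ys + triplesFrom f x ys

  triples : (A → A → A → ℕ) → List A → ℕ
  triples f []       = 0
  triples f (x ∷ xs) = triplesFrom f x xs + triples f xs

  module Colouring (κ : A → ℕ) where

    sameColour : A → A → A → ℕ
    sameColour x y z = 𝟙[ κ x ≟ κ y ] * 𝟙[ κ x ≟ κ z ]

    colourCount : List A → ℕ → ℕ
    colourCount []       c = 0
    colourCount (p ∷ ps) c = 𝟙[ κ p ≟ c ] + colourCount ps c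

    partner : ∀ x y S → κ y ≡ κ x → 1 ≤ colourCount S (κ x) → 1 ≤ pairsAfter sameColour x y S
    partner x y []      κy≡κx ()
    partner x y (z ∷ S) κy≡κx present with κ z ≟ κ x
    ... | yes κz≡κx = ≤-trans (*-mono-≤ (𝟙-intro (κ x ≟ κ y) (sym κy≡κx)) (𝟙-intro (κ x ≟ κ z) (sym κz≡κx))) (m≤m+n _ _)
    ... | no  _     = ≤-trans (partner x y S κy≡κx present) (m≤n+m _ _)

    twoPartners : ∀ x S → 2 ≤ colourCount S (κ x) → 1 ≤ triplesFrom sameColour x S
    twoPartners x []      ()
    twoPartners x (y ∷ S) two with κ y ≟ κ x
    ... | yes κy≡κx = ≤-trans (partner x y S κy≡κx (≤-pred two)) (m≤m+n _ _)
    ... | no  _     = ≤-trans (twoPartners x S two) (m≤n+m _ _)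

    potential : ℕ → List A → ℕ
    potential L S = sum L (λ c → colourCount S c ⊓ 2)

    capped-step : ∀ k → suc (k ⊓ 2) ≤ suc k ⊓ 2 + 𝟙[ 2 ≤? k ]
    capped-step zero          = ≤-refl
    capped-step (suc zero)    = ≤-refl
    capped-step (suc (suc k)) = ≤-reflexive (cong (3 +_) (⊓-zeroʳ k))

    potential-step : ∀ L x S → κ x < L →
      suc (potential L S) ≤ potential L (x ∷ S) + 𝟙[ 2 ≤? colourCount S (κ x) ]
    potential-step L x S κx<L = +-cancelʳ-≤ (k ⊓ 2) _ _ (begin
      suc (potential L S) + k ⊓ 2           ≡⟨ sym (+-suc (potential L S) (k ⊓ 2)) ⟩
      potential L S + suc (k ⊓ 2)           ≤⟨ +-monoʳ-≤ (potential L S) (capped-step k) ⟩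
      potential L S + (suc k ⊓ 2 + 𝟙[ 2 ≤? k ]) ≡⟨ sym (+-assoc (potential L S) _ _) ⟩
      potential L S + suc k ⊓ 2 + 𝟙[ 2 ≤? k ] ≡⟨ cong (_+ 𝟙[ 2 ≤? k ]) (sym bump) ⟩
      potential L (x ∷ S) + k ⊓ 2 + 𝟙[ 2 ≤? k ] ≡⟨ swap (potential L (x ∷ S)) (k ⊓ 2) _ ⟩
      potential L (x ∷ S) + 𝟙[ 2 ≤? k ] + k ⊓ 2 ∎)
      where
      open ≤-Reasoning
      k : ℕ
      k = colourCount S (κ x)
      bump : potential L (x ∷ S) + k ⊓ 2 ≡ potential L S + suc k ⊓ 2
      bump = trans (sum-update L (κ x) _ _ κx<L agree)
                   (cong (λ j → potential L S + (j + k) ⊓ 2) (𝟙-true (κ x ≟ κ x) refl))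
        where
        agree : ∀ c → c < L → c ≢ κ x → colourCount (x ∷ S) c ⊓ 2 ≡ colourCount S c ⊓ 2
        agree c _ c≢κx with κ x ≟ c
        ... | yes κx≡c = ⊥-elim (c≢κx (sym κx≡c))
        ... | no  _    = refl
      swap : ∀ x y z → x + y + z ≡ x + z + y
      swap = solve-∀

    monochromatic-potential : ∀ L S → All (λ p → κ p < L) S → length S ≤ triples sameColour S + potential L S
    monochromatic-potential L []      _            = z≤n
    monochromatic-potential L (x ∷ S) (κx<L ∷ κS<L) = begin
      suc (length S)                           ≤⟨ s≤s (monochromatic-potential L S κS<L) ⟩
      suc (t + potential L S)                  ≡⟨ sym (+-suc t (potential L S)) ⟩
      t + suc (potential L S)                  ≤⟨ +-monoʳ-≤ t (potential-step L x S κx<L) ⟩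
      t + (potential L (x ∷ S) + 𝟙[ 2 ≤? k ])  ≤⟨ +-monoʳ-≤ t (+-monoʳ-≤ (potential L (x ∷ S)) startsTriple) ⟩
      t + (potential L (x ∷ S) + t₀)           ≡⟨ rearrange t (potential L (x ∷ S)) t₀ ⟩
      t₀ + t + potential L (x ∷ S)             ∎
      where
      open ≤-Reasoning
      t t₀ k : ℕ
      t = triples sameColour S
      t₀ = triplesFrom sameColour x S
      k = colourCount S (κ x)
      startsTriple : 𝟙[ 2 ≤? k ] ≤ t₀
      startsTriple with 2 ≤? k
      ... | yes two = twoPartners x S two
      ... | no  _   = z≤n
      rearrange : ∀ a b c → a + (b + c) ≡ c + a + b
      rearrange = solve-∀

    monochromatic-bound : ∀ L S → All (λ p → κ p < L) S → length S ≤ triples sameColour S + 2 * L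
    monochromatic-bound L S κS<L = ≤-trans (monochromatic-potential L S κS<L)
      (+-monoʳ-≤ (triples sameColour S)
        (≤-trans (sum-mono L (λ c _ → m⊓n≤n (colourCount S c) 2)) (≤-reflexive (trans (sum-const L 2) (*-comm L 2)))))

module _ {A : Set} where

  pairsAfter-sum : ∀ m (F : ℕ → A → A → A → ℕ) x y S →
    pairsAfter (λ x y z → sum m (λ i → F i x y z)) x y S ≡ sum m (λ i → pairsAfter (F i) x y S)
  pairsAfter-sum m F x y []      = sym (trans (sum-const m 0) (*-zeroʳ m))
  pairsAfter-sum m F x y (z ∷ S) = trans (cong (sum m (λ i → F i x y z) +_) (pairsAfter-sum m F x y S)) (sym (sum-+ m _ _))

  triplesFrom-sum : ∀ m (F : ℕ → A → A → A → ℕ) x S →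
    triplesFrom (λ x y z → sum m (λ i → F i x y z)) x S ≡ sum m (λ i → triplesFrom (F i) x S)
  triplesFrom-sum m F x []      = sym (trans (sum-const m 0) (*-zeroʳ m))
  triplesFrom-sum m F x (y ∷ S) = trans (cong₂ _+_ (pairsAfter-sum m F x y S) (triplesFrom-sum m F x S)) (sym (sum-+ m _ _))

  triples-sum : ∀ m (F : ℕ → A → A → A → ℕ) S →
    triples (λ x y z → sum m (λ i → F i x y z)) S ≡ sum m (λ i → triples (F i) S)
  triples-sum m F []      = sym (trans (sum-const m 0) (*-zeroʳ m))
  triples-sum m F (x ∷ S) = trans (cong₂ _+_ (triplesFrom-sum m F x S) (triples-sum m F S)) (sym (sum-+ m _ _))

  pairsAfter-* : ∀ k (f : A → A → A → ℕ) x y S → pairsAfter (λ x y z → k * f x y z) x y S ≡ k * pairsAfter f x y S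
  pairsAfter-* k f x y []      = sym (*-zeroʳ k)
  pairsAfter-* k f x y (z ∷ S) = trans (cong (k * f x y z +_) (pairsAfter-* k f x y S)) (sym (*-distribˡ-+ k _ _))

  triplesFrom-* : ∀ k (f : A → A → A → ℕ) x S → triplesFrom (λ x y z → k * f x y z) x S ≡ k * triplesFrom f x S
  triplesFrom-* k f x []      = sym (*-zeroʳ k)
  triplesFrom-* k f x (y ∷ S) = trans (cong₂ _+_ (pairsAfter-* k f x y S) (triplesFrom-* k f x S)) (sym (*-distribˡ-+ k _ _))

  triples-* : ∀ k (f : A → A → A → ℕ) S → triples (λ x y z → k * f x y z) S ≡ k * triples f S
  triples-* k f []      = sym (*-zeroʳ k)
  triples-* k f (x ∷ S) = trans (cong₂ _+_ (triplesFrom-* k f x S) (triples-* k f S)) (sym (*-distribˡ-+ k _ _))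

  pairsAfter-mono : ∀ (f g : A → A → A → ℕ) x y → x ≢ y → (∀ x y z → x ≢ y → f x y z ≤ g x y z) →
    ∀ S → pairsAfter f x y S ≤ pairsAfter g x y S
  pairsAfter-mono f g x y x≢y f≤g []      = z≤n
  pairsAfter-mono f g x y x≢y f≤g (z ∷ S) = +-mono-≤ (f≤g x y z x≢y) (pairsAfter-mono f g x y x≢y f≤g S)

  triplesFrom-mono : ∀ (f g : A → A → A → ℕ) x S → All (x ≢_) S → (∀ x y z → x ≢ y → f x y z ≤ g x y z) →
    triplesFrom f x S ≤ triplesFrom g x S
  triplesFrom-mono f g x []      _            f≤g = z≤n
  triplesFrom-mono f g x (y ∷ S) (x≢y ∷ x≢S) f≤g =
    +-mono-≤ (pairsAfter-mono f g x y x≢y f≤g S) (triplesFrom-mono f g x S x≢S f≤g)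

  triples-mono : ∀ (f g : A → A → A → ℕ) S → Unique S → (∀ x y z → x ≢ y → f x y z ≤ g x y z) →
    triples f S ≤ triples g S
  triples-mono f g []      _              f≤g = z≤n
  triples-mono f g (x ∷ S) (x≢S ∷ unique) f≤g = +-mono-≤ (triplesFrom-mono f g x S x≢S f≤g) (triples-mono f g S unique f≤g)

xOf yOf zOf : ∀ {n} → Point n → ℕ
xOf (a , _ , _) = toℕ a
yOf (_ , b , _) = toℕ b
zOf (_ , _ , c) = toℕ c

point-≡ : ∀ {n} (p q : Point n) → xOf p ≡ xOf q → yOf p ≡ yOf q → zOf p ≡ zOf q → p ≡ q
point-≡ (_ , _ , _) (_ , _ , _) ex ey ez = cong₂ _,_ (toℕ-injective ex) (cong₂ _,_ (toℕ-injective ey) (toℕ-injective ez))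

Step : ∀ {n} → ℕ → ℕ → ℕ → Point n → Point n → ℕ → Set
Step t b c p q δ = xOf q ≡ xOf p + δ * t × yOf q ≡ yOf p + δ * b × zOf q ≡ zOf p + δ * c

OnLine : ∀ {n} → ℕ → ℕ → ℕ → Point n → Point n → Set
OnLine t b c p q = (∃[ δ ] Step t b c p q δ) ⊎ (∃[ δ ] Step t b c q p δ)

digits-unique : ∀ m r r′ A A′ → r < m → r′ < m → r + m * A ≡ r′ + m * A′ → r ≡ r′ × A ≡ A′
digits-unique zero      r r′ A A′ ()
digits-unique m@(suc _) r r′ A A′ r<m r′<m e =
  r≡r′ , *-cancelˡ-≡ A A′ m (+-cancelˡ-≡ r _ _ (trans e (cong (_+ m * A′) (sym r≡r′))))
  where
  low-digit : ∀ r A → r < m → (r + m * A) % m ≡ r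
  low-digit r A r<m = trans (cong (λ z → (r + z) % m) (*-comm m A)) (trans ([m+kn]%n≡m%n r A m) (m<n⇒m%n≡m r<m))
  r≡r′ : r ≡ r′
  r≡r′ = trans (sym (low-digit r A r<m)) (trans (cong (_% m) e) (low-digit r′ A′ r′<m))

-- Moving p back by ⌊x/t⌋ steps reaches the point of its line with x < t; the key encodes
-- that point, shifted by Q = ⌊n/t⌋ steps forward so that all coordinates stay in [0, 2n).
module LineKey (n t b c : ℕ) .{{_ : NonZero t}} where

  Q : ℕ
  Q = n / t

  layer : Point n → ℕ
  layer p = xOf p / t

  yRep zRep : Point n → ℕ
  yRep p = yOf p + b * (Q ∸ layer p)
  zRep p = zOf p + c * (Q ∸ layer p)

  key : Point n → ℕ
  key p = xOf p % t + t * (yRep p + 2 * n * zRep p)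

  layer≤Q : ∀ p → layer p ≤ Q
  layer≤Q (a , _ , _) = /-monoˡ-≤ t (<⇒≤ (toℕ<n a))

  rep-bound : ∀ v s p → v < n → s ≤ t → v + s * (Q ∸ layer p) < 2 * n
  rep-bound v s p v<n s≤t = begin-strict
    v + s * (Q ∸ layer p) <⟨ +-monoˡ-< _ v<n ⟩
    n + s * (Q ∸ layer p) ≤⟨ +-monoʳ-≤ n (≤-trans (*-monoʳ-≤ s (m∸n≤m Q (layer p))) sQ≤n) ⟩
    n + n                 ≡⟨ cong (n +_) (sym (+-identityʳ n)) ⟩
    2 * n                 ∎
    where
    open ≤-Reasoning
    sQ≤n : s * Q ≤ n
    sQ≤n = ≤-trans (*-monoˡ-≤ Q s≤t) (≤-trans (≤-reflexive (*-comm t Q)) (m/n*n≤m n t))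

  module _ (b≤t : b ≤ t) (c≤t : c ≤ t) where

    yRep< : ∀ p → yRep p < 2 * n
    yRep< p@(_ , y , _) = rep-bound (toℕ y) b p (toℕ<n y) b≤t

    zRep< : ∀ p → zRep p < 2 * n
    zRep< p@(_ , _ , z) = rep-bound (toℕ z) c p (toℕ<n z) c≤t

    key-bound : ∀ p → key p < t * (2 * n * (2 * n))
    key-bound p = begin-strict
      xOf p % t + t * A <⟨ +-monoˡ-< (t * A) (m%n<n (xOf p) t) ⟩
      t + t * A         ≡⟨ sym (*-suc t A) ⟩
      t * suc A         ≤⟨ *-monoʳ-≤ t A< ⟩
      t * (2 * n * (2 * n)) ∎
      where
      open ≤-Reasoning
      A : ℕ
      A = yRep p + 2 * n * zRep p
      A< : suc A ≤ 2 * n * (2 * n)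
      A< = begin
        suc (yRep p) + 2 * n * zRep p ≤⟨ +-monoˡ-≤ (2 * n * zRep p) (yRep< p) ⟩
        2 * n + 2 * n * zRep p        ≡⟨ sym (*-suc (2 * n) (zRep p)) ⟩
        2 * n * suc (zRep p)          ≤⟨ *-monoʳ-≤ (2 * n) (zRep< p) ⟩
        2 * n * (2 * n)               ∎

    same-representative : ∀ p q → xOf p % t ≡ xOf q % t → yRep p ≡ yRep q → zRep p ≡ zRep q →
      layer p ≤ layer q → Step t b c p q (layer q ∸ layer p)
    same-representative p q ex ey ez lp≤lq = x-step , side (yOf p) (yOf q) b ey , side (zOf p) (zOf q) c ez
      where
      δ : ℕ
      δ = layer q ∸ layer p
      x-step : xOf q ≡ xOf p + δ * t
      x-step = begin
        xOf q                                 ≡⟨ m≡m%n+[m/n]*n (xOf q) t ⟩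
        xOf q % t + layer q * t               ≡⟨ cong₂ (λ r l → r + l * t) (sym ex) (sym (m+[n∸m]≡n lp≤lq)) ⟩
        xOf p % t + (layer p + δ) * t         ≡⟨ distrib (xOf p % t) (layer p) δ t ⟩
        xOf p % t + layer p * t + δ * t       ≡⟨ cong (_+ δ * t) (sym (m≡m%n+[m/n]*n (xOf p) t)) ⟩
        xOf p + δ * t                         ∎
        where
        open ≡-Reasoning
        distrib : ∀ r a d t → r + (a + d) * t ≡ r + a * t + d * t
        distrib = solve-∀
      Q-layer : Q ∸ layer p ≡ δ + (Q ∸ layer q)
      Q-layer = begin
        Q ∸ layer p                          ≡⟨ cong (_∸ layer p) (sym (m+[n∸m]≡n (layer≤Q q))) ⟩
        layer q + (Q ∸ layer q) ∸ layer p    ≡⟨ +-∸-comm (Q ∸ layer q) lp≤lq ⟩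
        δ + (Q ∸ layer q)                    ∎
        where open ≡-Reasoning
      side : ∀ u v s → u + s * (Q ∸ layer p) ≡ v + s * (Q ∸ layer q) → v ≡ u + δ * s
      side u v s e = +-cancelʳ-≡ (s * E) v (u + δ * s) (trans (sym e) e′)
        where
        E : ℕ
        E = Q ∸ layer q
        e′ : u + s * (Q ∸ layer p) ≡ u + δ * s + s * E
        e′ = trans (cong (λ z → u + s * z) Q-layer) (expand u s δ E)
          where
          expand : ∀ u s d e → u + s * (d + e) ≡ u + d * s + s * e
          expand = solve-∀

    key-onLine : ∀ p q → key p ≡ key q → OnLine t b c p q
    key-onLine p q e
      with digits-unique t (xOf p % t) (xOf q % t) _ _ (m%n<n (xOf p) t) (m%n<n (xOf q) t) e
    ... | ex , eA with digits-unique (2 * n) (yRep p) (yRep q) (zRep p) (zRep q) (yRep< p) (yRep< q) eA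
    ... | ey , ez with ≤-total (layer p) (layer q)
    ... | inj₁ lp≤lq = inj₁ (layer q ∸ layer p , same-representative p q ex ey ez lp≤lq)
    ... | inj₂ lq≤lp = inj₂ (layer p ∸ layer q , same-representative q p (sym ex) (sym ey) (sym ez) lq≤lp)

-- The lines of direction (t, b, c) for every t ≥ 1 (the value at t = 0 is irrelevant).
lineKey : ∀ n → ℕ → ℕ → ℕ → Point n → ℕ
lineKey n zero      b c p = 0
lineKey n t@(suc _) b c p = LineKey.key n t b c p

lineKey-bound : ∀ n t b c → 1 ≤ t → b ≤ t → c ≤ t → ∀ p → lineKey n t b c p < t * (2 * n * (2 * n))
lineKey-bound n t@(suc _) b c _ b≤t c≤t = LineKey.key-bound n t b c b≤t c≤t

lineKey-onLine : ∀ n t b c → 1 ≤ t → b ≤ t → c ≤ t → ∀ p q →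
  lineKey n t b c p ≡ lineKey n t b c q → OnLine t b c p q
lineKey-onLine n t@(suc _) b c _ b≤t c≤t = LineKey.key-onLine n t b c b≤t c≤t

-- Points on a common line are collinear: the cross product of the integer differences
-- q − p = j₁·d and r − p = j₂·d vanishes.
module Collinearity where
  open ℤ using (+_)

  IntStep : ℕ → ℕ → ℤ.ℤ → ℕ → Set
  IntStep u v j s = + v ℤ.- + u ≡ j ℤ.* + s

  forward : ∀ u v δ s → v ≡ u + δ * s → IntStep u v (+ δ) s
  forward u v δ s refl = trans (cong (λ z → z ℤ.- + u) (trans (ℤP.pos-+ u (δ * s)) (cong (λ z → + u ℤ.+ z) (ℤP.pos-* δ s))))
                               (cancel (+ u) (+ δ) (+ s))
    where
    cancel : ∀ a d s → (a ℤ.+ d ℤ.* s) ℤ.- a ≡ d ℤ.* s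
    cancel = ℤ-Ring.solve-∀

  backward : ∀ u v δ s → u ≡ v + δ * s → IntStep u v (ℤ.- + δ) s
  backward u v δ s refl = trans (cong (λ z → + v ℤ.- z) (trans (ℤP.pos-+ v (δ * s)) (cong (λ z → + v ℤ.+ z) (ℤP.pos-* δ s))))
                                (cancel (+ v) (+ δ) (+ s))
    where
    cancel : ∀ a d s → a ℤ.- (a ℤ.+ d ℤ.* s) ≡ (ℤ.- d) ℤ.* s
    cancel = ℤ-Ring.solve-∀

  Displacement : ∀ {n} → ℕ → ℕ → ℕ → Point n → Point n → ℤ.ℤ → Set
  Displacement t b c p q j = IntStep (xOf p) (xOf q) j t × IntStep (yOf p) (yOf q) j b × IntStep (zOf p) (zOf q) j c

  onLine⇒displacement : ∀ {n} t b c (p q : Point n) → OnLine t b c p q → ∃[ j ] Displacement t b c p q j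
  onLine⇒displacement t b c p q (inj₁ (δ , ex , ey , ez)) =
    + δ , forward _ _ δ t ex , forward _ _ δ b ey , forward _ _ δ c ez
  onLine⇒displacement t b c p q (inj₂ (δ , ex , ey , ez)) =
    ℤ.- + δ , backward _ _ δ t ex , backward _ _ δ b ey , backward _ _ δ c ez

  cross-zero : ∀ j₁ j₂ w₁ w₂ u₁ u₂ v₁ v₂ → u₁ ≡ j₁ ℤ.* w₁ → u₂ ≡ j₁ ℤ.* w₂ → v₁ ≡ j₂ ℤ.* w₁ → v₂ ≡ j₂ ℤ.* w₂ →
    isZero (u₁ ℤ.* v₂ ℤ.- u₂ ℤ.* v₁) ≡ true
  cross-zero j₁ j₂ w₁ w₂ _ _ _ _ refl refl refl refl = cong isZero (parallel j₁ j₂ w₁ w₂)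
    where
    parallel : ∀ a b x y → (a ℤ.* x) ℤ.* (b ℤ.* y) ℤ.- (a ℤ.* y) ℤ.* (b ℤ.* x) ≡ + 0
    parallel = ℤ-Ring.solve-∀

  displacement⇒collinear : ∀ {n} t b c (p q r : Point n) j₁ j₂ →
    Displacement t b c p q j₁ → Displacement t b c p r j₂ → collinear p q r ≡ true
  displacement⇒collinear t b c p q r j₁ j₂ (x₁ , y₁ , z₁) (x₂ , y₂ , z₂) =
    cong₂ _∧_ (cross-zero j₁ j₂ (+ b) (+ c) _ _ _ _ y₁ z₁ y₂ z₂)
      (cong₂ _∧_ (cross-zero j₁ j₂ (+ c) (+ t) _ _ _ _ z₁ x₁ z₂ x₂) (cross-zero j₁ j₂ (+ t) (+ b) _ _ _ _ x₁ y₁ x₂ y₂))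

  onLine⇒collinear : ∀ {n} t b c (p q r : Point n) → OnLine t b c p q → OnLine t b c p r → collinear p q r ≡ true
  onLine⇒collinear t b c p q r pq pr with onLine⇒displacement t b c p q pq | onLine⇒displacement t b c p r pr
  ... | j₁ , d₁ | j₂ , d₂ = displacement⇒collinear t b c p q r j₁ j₂ d₁ d₂

open Collinearity using (onLine⇒collinear)

step-zero : ∀ {n} t b c (p q : Point n) → Step t b c p q 0 → p ≡ q
step-zero t b c p q (ex , ey , ez) =
  point-≡ p q (sym (trans ex (+-identityʳ _))) (sym (trans ey (+-identityʳ _))) (sym (trans ez (+-identityʳ _)))

-- With t, t′ ≥ 1 the x-coordinate strictly increases along a step, so one cannot step
-- from p to q in one direction and back from q to p in another.
no-return : ∀ {n} t b c t′ b′ c′ (p q : Point n) δ δ′ → 1 ≤ t →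
  Step t b c p q δ → Step t′ b′ c′ q p δ′ → p ≢ q → ⊥
no-return t b c t′ b′ c′ p q δ δ′ 1≤t pq@(x-pq , _ , _) (x-qp , _ , _) p≢q =
  p≢q (step-zero t b c p q (subst (Step t b c p q) δ≡0 pq))
  where
  round-trip : xOf p + 0 ≡ xOf p + (δ * t + δ′ * t′)
  round-trip = trans (+-identityʳ _) (trans x-qp (trans (cong (_+ δ′ * t′) x-pq) (+-assoc (xOf p) _ _)))
  δ≡0 : δ ≡ 0
  δ≡0 = m*n≡0⇒m≡0 δ t {{>-nonZero 1≤t}} (m+n≡0⇒m≡0 (δ * t) (sym (+-cancelˡ-≡ (xOf p) _ _ round-trip)))

divides-multiplier : ∀ δ δ′ t b c t′ b′ c′ → gcd t (gcd b c) ≡ 1 →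
  δ * t ≡ δ′ * t′ → δ * b ≡ δ′ * b′ → δ * c ≡ δ′ * c′ → δ′ ∣ δ
divides-multiplier δ δ′ t b c t′ b′ c′ prim et eb ec =
  subst (δ′ ∣_) δ·gcd≡δ (gcd-greatest (divides t′ et) (gcd-greatest (divides b′ eb) (divides c′ ec)))
  where
  divides : ∀ {u} v → δ * u ≡ δ′ * v → δ′ ∣ δ * u
  divides v e = subst (δ′ ∣_) (sym e) (m∣m*n v)
  δ·gcd≡δ : gcd (δ * t) (gcd (δ * b) (δ * c)) ≡ δ
  δ·gcd≡δ = begin
    gcd (δ * t) (gcd (δ * b) (δ * c)) ≡⟨ cong (gcd (δ * t)) (sym (c*gcd[m,n]≡gcd[cm,cn] δ b c)) ⟩
    gcd (δ * t) (δ * gcd b c)         ≡⟨ sym (c*gcd[m,n]≡gcd[cm,cn] δ t (gcd b c)) ⟩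
    δ * gcd t (gcd b c)               ≡⟨ cong (δ *_) prim ⟩
    δ * 1                             ≡⟨ *-identityʳ δ ⟩
    δ                                 ∎
    where open ≡-Reasoning

step-direction-unique : ∀ {n} t b c t′ b′ c′ (p q : Point n) δ δ′ →
  gcd t (gcd b c) ≡ 1 → gcd t′ (gcd b′ c′) ≡ 1 →
  Step t b c p q δ → Step t′ b′ c′ p q δ′ → p ≢ q → t ≡ t′ × b ≡ b′ × c ≡ c′
step-direction-unique t b c t′ b′ c′ p q δ δ′ prim prim′ pq@(x , y , z) (x′ , y′ , z′) p≢q
  with δ ≟ 0
... | yes δ≡0 = ⊥-elim (p≢q (step-zero t b c p q (subst (Step t b c p q) δ≡0 pq)))
... | no  δ≢0 = cancel et , cancel eb , cancel ec
  where
  et : δ * t ≡ δ′ * t′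
  et = +-cancelˡ-≡ (xOf p) _ _ (trans (sym x) x′)
  eb : δ * b ≡ δ′ * b′
  eb = +-cancelˡ-≡ (yOf p) _ _ (trans (sym y) y′)
  ec : δ * c ≡ δ′ * c′
  ec = +-cancelˡ-≡ (zOf p) _ _ (trans (sym z) z′)
  δ≡δ′ : δ ≡ δ′
  δ≡δ′ = ∣-antisym (divides-multiplier δ′ δ t′ b′ c′ t b c prim′ (sym et) (sym eb) (sym ec))
                   (divides-multiplier δ δ′ t b c t′ b′ c′ prim et eb ec)
  cancel : ∀ {u v} → δ * u ≡ δ′ * v → u ≡ v
  cancel {u} {v} e = *-cancelˡ-≡ u v δ {{≢-nonZero δ≢0}} (trans e (cong (_* v) (sym δ≡δ′)))

onLine-direction-unique : ∀ {n} t b c t′ b′ c′ (p q : Point n) → 1 ≤ t → 1 ≤ t′ →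
  gcd t (gcd b c) ≡ 1 → gcd t′ (gcd b′ c′) ≡ 1 →
  OnLine t b c p q → OnLine t′ b′ c′ p q → p ≢ q → t ≡ t′ × b ≡ b′ × c ≡ c′
onLine-direction-unique t b c t′ b′ c′ p q _ _ prim prim′ (inj₁ (δ , s)) (inj₁ (δ′ , s′)) p≢q =
  step-direction-unique t b c t′ b′ c′ p q δ δ′ prim prim′ s s′ p≢q
onLine-direction-unique t b c t′ b′ c′ p q _ _ prim prim′ (inj₂ (δ , s)) (inj₂ (δ′ , s′)) p≢q =
  step-direction-unique t b c t′ b′ c′ q p δ δ′ prim prim′ s s′ (≢-sym p≢q)
onLine-direction-unique t b c t′ b′ c′ p q 1≤t _ _ _ (inj₁ (δ , s)) (inj₂ (δ′ , s′)) p≢q =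
  ⊥-elim (no-return t b c t′ b′ c′ p q δ δ′ 1≤t s s′ p≢q)
onLine-direction-unique t b c t′ b′ c′ p q _ 1≤t′ _ _ (inj₂ (δ , s)) (inj₁ (δ′ , s′)) p≢q =
  ⊥-elim (no-return t′ b′ c′ t b c p q δ′ δ 1≤t′ s′ s p≢q)

collinearity : ∀ {n} → Point n → Point n → Point n → ℕ
collinearity x y z = if collinear x y z then 1 else 0

-- `spanned` is the triple count of `collinearity`.  Its auxiliary sums are private to Defs,
-- so they are referred to as the first summands of the sums they occur in.
firstSummand : ∀ {a b c : ℕ} → a + b ≡ c → ℕ
firstSummand {a} _ = a

spannedFrom : ∀ {n} → Point n → List (Point n) → ℕ
spannedFrom x xs = firstSummand {b = spanned xs} {c = spanned (x ∷ xs)} refl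

spannedPairs : ∀ {n} → Point n → Point n → List (Point n) → ℕ
spannedPairs x y ys = firstSummand {b = spannedFrom x ys} {c = spannedFrom x (y ∷ ys)} refl

spannedPairs-≡ : ∀ {n} (x y : Point n) ys → spannedPairs x y ys ≡ pairsAfter collinearity x y ys
spannedPairs-≡ x y []       = refl
spannedPairs-≡ x y (z ∷ zs) = cong (collinearity x y z +_) (spannedPairs-≡ x y zs)

spannedFrom-≡ : ∀ {n} (x : Point n) xs → spannedFrom x xs ≡ triplesFrom collinearity x xs
spannedFrom-≡ x []       = refl
spannedFrom-≡ x (y ∷ ys) = cong₂ _+_ (spannedPairs-≡ x y ys) (spannedFrom-≡ x ys)

spanned-≡ : ∀ {n} (S : List (Point n)) → spanned S ≡ triples collinearity S
spanned-≡ []       = refl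
spanned-≡ (x ∷ xs) = cong₂ _+_ (spannedFrom-≡ x xs) (spanned-≡ xs)

InBox : ℕ → ℕ → ℕ → ℕ → Set
InBox T i b c = i < T × b < T × c < T

directionSum-pos : ∀ T h → 1 ≤ directionSum T h → ∃[ i ] ∃[ b ] ∃[ c ] (InBox T i b c × 1 ≤ h (T + i) b c)
directionSum-pos T h pos with sum²-pos T T (λ i b → sum T (h (T + i) b)) pos
... | i , b , i<T , b<T , cell-pos with sum-pos T (h (T + i) b) cell-pos
... | c , c<T , hibc = i , b , c , (i<T , b<T , c<T) , hibc

directionSum≤1 : ∀ T h → (∀ i b c → InBox T i b c → h (T + i) b c ≤ 1) →
  (∀ i b c i′ b′ c′ → InBox T i b c → InBox T i′ b′ c′ → 1 ≤ h (T + i) b c → 1 ≤ h (T + i′) b′ c′ →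
     T + i ≡ T + i′ × b ≡ b′ × c ≡ c′) →
  directionSum T h ≤ 1
directionSum≤1 T h bounded unique = sum²≤1 T T cell cell≤1 cell-unique
  where
  cell : ℕ → ℕ → ℕ
  cell i b = sum T (h (T + i) b)
  cell≤1 : ∀ i b → i < T → b < T → cell i b ≤ 1
  cell≤1 i b i<T b<T = sum≤1 T _ (λ c c<T → bounded i b c (i<T , b<T , c<T))
    (λ c c′ c<T c′<T p p′ → proj₂ (proj₂ (unique i b c i b c′ (i<T , b<T , c<T) (i<T , b<T , c′<T) p p′)))
  cell-unique : ∀ i b i′ b′ → i < T → b < T → i′ < T → b′ < T → 1 ≤ cell i b → 1 ≤ cell i′ b′ → i ≡ i′ × b ≡ b′
  cell-unique i b i′ b′ i<T b<T i′<T b′<T p p′ with sum-pos T _ p | sum-pos T _ p′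
  ... | c , c<T , q | c′ , c′<T , q′ with unique i b c i′ b′ c′ (i<T , b<T , c<T) (i′<T , b′<T , c′<T) q q′
  ...   | t≡t′ , b≡b′ , _ = +-cancelˡ-≡ T i i′ t≡t′ , b≡b′

≤-indicator : ∀ s (β : Bool) → s ≤ 1 → (1 ≤ s → β ≡ true) → s ≤ (if β then 1 else 0)
≤-indicator s true  s≤1 _    = s≤1
≤-indicator s false s≤1 β-if = ≤-reflexive (n≤0⇒n≡0 (≮⇒≥ (λ pos → contradiction (β-if pos))))
  where
  contradiction : false ≡ true → ⊥
  contradiction ()

module Counting (n J : ℕ) where

  T : ℕ
  T = 2 ^ J

  1≤T : 1 ≤ T
  1≤T = m^n>0 2 J

  box-shape : ∀ {i b c} → InBox T i b c → 1 ≤ T + i × b ≤ T + i × c ≤ T + i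
  box-shape {i} (_ , b<T , c<T) = ≤-trans 1≤T (m≤m+n T i) , ≤-trans (<⇒≤ b<T) (m≤m+n T i) , ≤-trans (<⇒≤ c<T) (m≤m+n T i)

  sameLine : ℕ → ℕ → ℕ → Point n → Point n → Point n → ℕ
  sameLine t b c = Colouring.sameColour (lineKey n t b c)

  commonLine : ℕ → ℕ → ℕ → Point n → Point n → Point n → ℕ
  commonLine t b c x y z = isPrimitive t b c * sameLine t b c x y z

  commonLine≤1 : ∀ t b c x y z → commonLine t b c x y z ≤ 1
  commonLine≤1 t b c x y z = *-mono-≤ (𝟙≤1 (primitive? t b c)) (*-mono-≤ (𝟙≤1 (lineKey n t b c x ≟ _)) (𝟙≤1 (lineKey n t b c x ≟ _)))

  commonLine-pos : ∀ t b c x y z → 1 ≤ commonLine t b c x y z →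
    gcd t (gcd b c) ≡ 1 × lineKey n t b c x ≡ lineKey n t b c y × lineKey n t b c x ≡ lineKey n t b c z
  commonLine-pos t b c x y z pos with 1≤*-split _ _ pos
  ... | prim , same with 1≤*-split _ _ same
  ...   | xy , xz = 𝟙-elim (primitive? t b c) prim , 𝟙-elim (_ ≟ _) xy , 𝟙-elim (_ ≟ _) xz

  directions-through : ∀ x y z → x ≢ y → directionSum T (λ t b c → commonLine t b c x y z) ≤ collinearity x y z
  directions-through x y z x≢y = ≤-indicator _ (collinear x y z)
    (directionSum≤1 T (λ t b c → commonLine t b c x y z) (λ i b c _ → commonLine≤1 (T + i) b c x y z) one-direction)
    collinear-if-counted
    where
    onLine : ∀ {i b c} → InBox T i b c → ∀ p q → lineKey n (T + i) b c p ≡ lineKey n (T + i) b c q →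
      OnLine (T + i) b c p q
    onLine box = let (1≤t , b≤t , c≤t) = box-shape box in lineKey-onLine n _ _ _ 1≤t b≤t c≤t
    one-direction : ∀ i b c i′ b′ c′ → InBox T i b c → InBox T i′ b′ c′ →
      1 ≤ commonLine (T + i) b c x y z → 1 ≤ commonLine (T + i′) b′ c′ x y z → T + i ≡ T + i′ × b ≡ b′ × c ≡ c′
    one-direction i b c i′ b′ c′ box box′ pos pos′ =
      let (prim  , xy  , _) = commonLine-pos (T + i) b c x y z pos
          (prim′ , xy′ , _) = commonLine-pos (T + i′) b′ c′ x y z pos′
      in onLine-direction-unique (T + i) b c (T + i′) b′ c′ x y (proj₁ (box-shape box)) (proj₁ (box-shape box′))
           prim prim′ (onLine box x y xy) (onLine box′ x y xy′) x≢y
    collinear-if-counted : 1 ≤ directionSum T (λ t b c → commonLine t b c x y z) → collinear x y z ≡ true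
    collinear-if-counted pos =
      let (i , b , c , box , counted) = directionSum-pos T (λ t b c → commonLine t b c x y z) pos
          (_ , xy , xz) = commonLine-pos (T + i) b c x y z counted
      in onLine⇒collinear (T + i) b c x y z (onLine box x y xy) (onLine box x z xz)

  lineTriples : List (Point n) → ℕ → ℕ → ℕ → ℕ
  lineTriples S t b c = isPrimitive t b c * triples (sameLine t b c) S

  -- Every collinear triple is counted along at most one primitive direction of the box.
  directions-total : ∀ S → Unique S → directionSum T (lineTriples S) ≤ spanned S
  directions-total S unique = begin
    directionSum T (lineTriples S) ≡⟨ sym interchange ⟩
    triples (λ x y z → directionSum T (λ t b c → commonLine t b c x y z)) S
      ≤⟨ triples-mono _ collinearity S unique directions-through ⟩
    triples collinearity S ≡⟨ sym (spanned-≡ S) ⟩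
    spanned S ∎
    where
    open ≤-Reasoning
    interchange : triples (λ x y z → directionSum T (λ t b c → commonLine t b c x y z)) S
                ≡ directionSum T (lineTriples S)
    interchange = trans (triples-sum T _ S) (sum-cong T (λ i _ → trans (triples-sum T _ S) (sum-cong T (λ b _ →
                    trans (triples-sum T _ S) (sum-cong T (λ c _ → triples-* (isPrimitive (T + i) b c) (sameLine (T + i) b c) S))))))

  module _ (S : List (Point n)) (unique : Unique S) (dense : 32 * T * (n * n) ≤ length S) where

    m : ℕ
    m = length S

    -- The lines of one box direction meeting [n]³ number fewer than 8Tn², so the
    -- density assumption m ≥ 32Tn² forces m ≤ 2·#(triples on a common line).
    lines-crowded : ∀ i b c → InBox T i b c → m ≤ 2 * triples (sameLine (T + i) b c) S
    lines-crowded i b c box = +-cancelʳ-≤ (32 * T * (n * n)) m (2 * M) (begin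
      m + 32 * T * (n * n)      ≤⟨ +-monoʳ-≤ m dense ⟩
      m + m                     ≤⟨ +-mono-≤ colouring colouring ⟩
      (M + 2 * colours) + (M + 2 * colours) ≡⟨ regroup M T n ⟩
      2 * M + 32 * T * (n * n)  ∎)
      where
      open ≤-Reasoning
      M colours : ℕ
      M = triples (sameLine (T + i) b c) S
      colours = 2 * T * (2 * n * (2 * n))
      key<L : ∀ p → lineKey n (T + i) b c p < colours
      key<L p = let (1≤t , b≤t , c≤t) = box-shape box in <-≤-trans (lineKey-bound n (T + i) b c 1≤t b≤t c≤t p)
        (*-monoˡ-≤ (2 * n * (2 * n)) (≤-trans (+-monoʳ-≤ T (<⇒≤ (proj₁ box))) (≤-reflexive (cong (T +_) (sym (+-identityʳ T))))))
      colouring : m ≤ M + 2 * colours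
      colouring = Colouring.monochromatic-bound (lineKey n (T + i) b c) colours S (tabulate (λ {p} _ → key<L p))
      regroup : ∀ M T n → (M + 2 * (2 * T * (2 * n * (2 * n)))) + (M + 2 * (2 * T * (2 * n * (2 * n))))
                        ≡ 2 * M + 32 * T * (n * n)
      regroup = solve-∀

    -- At least T³/2 primitive directions, each carrying at least m/2 triples of S.
    cube-bound : T * T * T * m ≤ 4 * spanned S
    cube-bound = begin
      T * T * T * m                  ≤⟨ *-monoˡ-≤ m (primitive-many J) ⟩
      2 * P * m                      ≡⟨ *-assoc 2 P m ⟩
      2 * (P * m)                    ≡⟨ cong (2 *_) (sym (directionSum-*ʳ T m isPrimitive)) ⟩
      2 * directionSum T (λ t b c → isPrimitive t b c * m)
        ≤⟨ *-monoʳ-≤ 2 (directionSum-mono T {λ t b c → isPrimitive t b c * m} {λ t b c → 2 * lineTriples S t b c}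
             (λ i b c i<T b<T c<T → ≤-trans (*-monoʳ-≤ (isPrimitive (T + i) b c) (lines-crowded i b c (i<T , b<T , c<T)))
                                             (≤-reflexive (*-comm-left (isPrimitive (T + i) b c) _)))) ⟩
      2 * directionSum T (λ t b c → 2 * lineTriples S t b c)
        ≡⟨ cong (2 *_) (directionSum-*ˡ T 2 (lineTriples S)) ⟩
      2 * (2 * directionSum T (lineTriples S))
        ≤⟨ *-monoʳ-≤ 2 (*-monoʳ-≤ 2 (directions-total S unique)) ⟩
      2 * (2 * spanned S)            ≡⟨ sym (*-assoc 2 2 (spanned S)) ⟩
      4 * spanned S                  ∎
      where
      open ≤-Reasoning
      P : ℕ
      P = directionSum T isPrimitive
      *-comm-left : ∀ a b → a * (2 * b) ≡ 2 * (a * b)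
      *-comm-left = solve-∀

    -- With also m < 64Tn²: m⁴ ≤ (64Tn²)³·m ≤ 64³·n⁶·(T³m) ≤ 2²⁰·n⁶·spanned S.
    fourth-power-bound : m < 64 * T * (n * n) → m * m * m * m ≤ 1048576 * (n * n * (n * n) * (n * n)) * spanned S
    fourth-power-bound sparse = begin
      m * m * m * m                       ≤⟨ *-monoˡ-≤ m (*-mono-≤ (*-mono-≤ m≤X m≤X) m≤X) ⟩
      X * X * X * m                       ≡⟨ expand 64 T (n * n) m ⟩
      64 * 64 * 64 * n⁶ * (T * T * T * m) ≤⟨ *-monoʳ-≤ (64 * 64 * 64 * n⁶) cube-bound ⟩
      64 * 64 * 64 * n⁶ * (4 * spanned S) ≡⟨ collect (64 * 64 * 64) n⁶ (spanned S) ⟩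
      1048576 * n⁶ * spanned S            ∎
      where
      open ≤-Reasoning
      X n⁶ : ℕ
      X = 64 * T * (n * n)
      n⁶ = n * n * (n * n) * (n * n)
      m≤X : m ≤ X
      m≤X = <⇒≤ sparse
      expand : ∀ a t s m → (a * t * s) * (a * t * s) * (a * t * s) * m ≡ a * a * a * (s * s * s) * (t * t * t * m)
      expand = solve-∀
      collect : ∀ k a s → k * a * (4 * s) ≡ k * 4 * a * s
      collect = solve-∀

-- From 0 ≤ s < 1 a rational p/q with p < q and s < p/q, written as s < (3q − (3q − p))/q
-- so that AtLeastPow3 applies to the exponent (3q − p)/q > 2.
exponent-below-one : (s : ℝ) → ¬ (s <ʳ 0ℚ) → s <ʳ 1ℚ →
  ∃[ p ] ∃[ d ] (p < suc d × s <ʳ ((ℤ.+ (3 * suc d) ℤ.- ℤ.+ (3 * suc d ∸ p)) ℚ./ suc d))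
exponent-below-one s s≮0 s<1 with roundedU₁ s 1ℚ s<1
... | mkℚ ℤ.-[1+ k ] d coprime , _ , s<r = ⊥-elim (s≮0 (roundedU₂ s 0ℚ (mkℚ ℤ.-[1+ k ] d coprime) (ℚ.*<* ℤ.-<+) s<r))
... | r@(mkℚ (ℤ.+ p) d _) , ℚ.*<* r<1 , s<r = p , d , p<q , subst (U s) (sym r≡) s<r
  where
  q : ℕ
  q = suc d
  p<q : p < q
  p<q = ℤP.drop‿+<+ (subst₂ ℤ._<_ (ℤP.*-identityʳ (ℤ.+ p)) (ℤP.*-identityˡ (ℤ.+ q)) r<1)
  numerator : ℤ.+ (3 * q) ℤ.- ℤ.+ (3 * q ∸ p) ≡ ℤ.+ p
  numerator = trans (ℤP.m-n≡m⊖n (3 * q) (3 * q ∸ p))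
    (trans (ℤP.⊖-≥ (m∸n≤m (3 * q) p)) (cong ℤ.+_ (m∸[m∸n]≡n (≤-trans (<⇒≤ p<q) (m≤m+n q _)))))
  r≡ : (ℤ.+ (3 * q) ℤ.- ℤ.+ (3 * q ∸ p)) ℚ./ q ≡ r
  r≡ = trans (cong (ℚ._/ q) numerator) (ℚP.↥p/↧p≡p r)

^-distribʳ-* : ∀ x y e → (x * y) ^ e ≡ x ^ e * y ^ e
^-distribʳ-* x y zero    = refl
^-distribʳ-* x y (suc e) = trans (cong (x * y *_) (^-distribʳ-* x y e)) (interchange x y (x ^ e) (y ^ e))
  where
  interchange : ∀ x y a c → x * y * (a * c) ≡ x * a * (y * c)
  interchange = solve-∀

-- n^(3q−p) ≤ m^q with p < q forces m ≥ 32n² once n ≥ 32^q, since 3q − p ≥ 2q + 1.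
dense-from-power : ∀ n m p q → p < q → 32 ^ q ≤ n → n ^ (3 * q ∸ p) ≤ m ^ q → 32 * (n * n) ≤ m
dense-from-power n m p q p<q 32^q≤n n^e≤m^q with 32 * (n * n) ≤? m
... | yes dense = dense
... | no  sparse = ⊥-elim (<-irrefl refl (<-≤-trans (begin-strict
  m ^ q                    <⟨ ^-monoˡ-< q (≰⇒> sparse) ⟩
  (32 * (n * n)) ^ q       ≡⟨ ^-distribʳ-* 32 (n * n) q ⟩
  32 ^ q * (n * n) ^ q     ≤⟨ *-monoˡ-≤ ((n * n) ^ q) 32^q≤n ⟩
  n * (n * n) ^ q          ≡⟨ cong (n *_) (trans (^-distribʳ-* n n q) (sym (^-distribˡ-+-* n q q))) ⟩
  n ^ suc (q + q)          ≤⟨ ^-monoʳ-≤ n {{n≢0}} exponent ⟩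
  n ^ (3 * q ∸ p)          ∎) n^e≤m^q))
  where
  open ≤-Reasoning
  instance
    n≢0 : NonZero n
    n≢0 = >-nonZero (≤-trans (m^n>0 32 q) 32^q≤n)
    q≢0 : NonZero q
    q≢0 = >-nonZero (≤-<-trans z≤n p<q)
  exponent : suc (q + q) ≤ 3 * q ∸ p
  exponent = m+n≤o⇒m≤o∸n (suc (q + q)) (begin
    suc (q + q) + p  ≡⟨ shift q p ⟩
    q + q + suc p    ≤⟨ +-monoʳ-≤ (q + q) p<q ⟩
    q + q + q        ≡⟨ triple q ⟩
    3 * q            ∎)
    where
    shift : ∀ q p → suc (q + q) + p ≡ q + q + suc p
    shift = solve-∀
    triple : ∀ q → q + q + q ≡ 3 * q
    triple = solve-∀

n<2^n : ∀ m → m < 2 ^ m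
n<2^n zero    = s≤s z≤n
n<2^n (suc m) = begin
  2 + m         ≡⟨ +-comm 2 m ⟩
  m + 2         ≡⟨ +-suc m 1 ⟩
  suc m + 1     ≤⟨ +-mono-≤ (n<2^n m) (m^n>0 2 m) ⟩
  2 ^ m + 2 ^ m ≡⟨ cong (2 ^ m +_) (sym (+-identityʳ (2 ^ m))) ⟩
  2 ^ suc m     ∎
  where open ≤-Reasoning

dyadic-window : ∀ A m → 1 ≤ A → 32 * A ≤ m → ∃[ J ] (32 * 2 ^ J * A ≤ m × m < 64 * 2 ^ J * A)
dyadic-window A m 1≤A 32A≤m = search m 0 (subst (_≤ m) (cong (_* A) (sym (*-identityʳ 32))) 32A≤m) initial
  where
  initial : m < 32 * 2 ^ (0 + m) * A
  initial = <-≤-trans (n<2^n m) (≤-trans (m≤n*m (2 ^ m) 32) (m≤m*n (32 * 2 ^ m) A {{>-nonZero 1≤A}}))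
  -- search upwards from J, knowing the window is found within `fuel` doublings
  search : ∀ fuel J → 32 * 2 ^ J * A ≤ m → m < 32 * 2 ^ (J + fuel) * A →
    ∃[ J ] (32 * 2 ^ J * A ≤ m × m < 64 * 2 ^ J * A)
  search zero     J lo hi = ⊥-elim (<⇒≱ hi (subst (λ e → 32 * 2 ^ e * A ≤ m) (sym (+-identityʳ J)) lo))
  search (suc fuel) J lo hi with m <? 64 * 2 ^ J * A
  ... | yes below = J , lo , below
  ... | no  above = search fuel (suc J) (subst (_≤ m) (sym (double (2 ^ J) A)) (≮⇒≥ above))
                           (subst (λ e → m < 32 * 2 ^ e * A) (+-suc J fuel) hi)
    where
    double : ∀ x A → 32 * (2 * x) * A ≡ 64 * x * A
    double = solve-∀

-- EdgeBound with the constant C replaced by an arbitrary K (so that C is never unfolded).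
EdgeBoundWith : ℕ → ℕ → ℝ → ℕ → Set
EdgeBoundWith K n s E =
  ∀ (a b′ c d′ : ℕ) → let b = suc b′ ; d = suc d′ in
    s <ʳ ((ℤ.+ (6 * b) ℤ.- ℤ.+ a) ℚ./ (4 * b)) →
    (c * K * E) ^ b < d ^ b * n ^ a →
    2 ^ c ≤ n ^ d

^-cancelˡ-< : ∀ {x y} e → x ^ e < y ^ e → x < y
^-cancelˡ-< {x} {y} e x^e<y^e with x <? y
... | yes x<y = x<y
... | no  x≮y = ⊥-elim (<⇒≱ x^e<y^e (^-monoˡ-≤ e (≮⇒≥ x≮y)))

-- m ≥ n^(3−s) at the exponent (a + 6b)/(4b), which is below 3 − s exactly when a/b < 6 − 4s:
-- the numerators 3·4b − (a + 6b) and 6b − a agree.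
atLeastPow3-shift : ∀ n s m a b′ → let b = suc b′ in AtLeastPow3 n s m →
  s <ʳ ((ℤ.+ (6 * b) ℤ.- ℤ.+ a) ℚ./ (4 * b)) → n ^ (a + 6 * b) ≤ m ^ (4 * b)
atLeastPow3-shift n s m a b′ m≥ s< = m≥ (a + 6 * b) (b′ + 3 * b) (subst (λ num → s <ʳ (num ℚ./ (4 * b))) (sym numerator) s<)
  where
  open ℤ using (+_)
  b : ℕ
  b = suc b′
  numerator : + (3 * (4 * b)) ℤ.- + (a + 6 * b) ≡ + (6 * b) ℤ.- + a
  numerator = trans (cong₂ ℤ._-_ (trans (cong +_ (twelve b)) (ℤP.pos-+ (6 * b) (6 * b))) (ℤP.pos-+ a (6 * b)))
                    (cancel (+ (6 * b)) (+ a))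
    where
    twelve : ∀ b → 3 * (4 * b) ≡ 6 * b + 6 * b
    twelve = solve-∀
    cancel : ∀ x a → (x ℤ.+ x) ℤ.- (a ℤ.+ x) ≡ x ℤ.- a
    cancel = ℤ-Ring.solve-∀

-- Turning m⁴ ≤ K·n⁶·E and m ≥ n^(3−s) into E ≥ n^(6−4s)/(K·log₂ n): for a/b < 6 − 4s we get
-- n^a ≤ (K·E)^b, so (c·K·E)^b < d^b·n^a forces c < d and hence 2^c ≤ 2^d ≤ n^d.
edgeBound-from : ∀ n s m E K → 2 ≤ n → AtLeastPow3 n s m → m ^ 4 ≤ K * (n ^ 6 * E) → EdgeBoundWith K n s E
edgeBound-from n s m E K 2≤n m≥ quartic a b′ c d′ s< below =
  ≤-trans (^-monoʳ-≤ 2 (<⇒≤ c<d)) (^-monoˡ-≤ d 2≤n)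
  where
  b d : ℕ
  b = suc b′
  d = suc d′
  n^a≤ : n ^ a ≤ (K * E) ^ b
  n^a≤ = *-cancelˡ-≤ (n ^ (6 * b)) {{>-nonZero (m^n>0 n (6 * b))}} (begin
    n ^ (6 * b) * n ^ a      ≡⟨ *-comm (n ^ (6 * b)) (n ^ a) ⟩
    n ^ a * n ^ (6 * b)      ≡⟨ sym (^-distribˡ-+-* n a (6 * b)) ⟩
    n ^ (a + 6 * b)          ≤⟨ atLeastPow3-shift n s m a b′ m≥ s< ⟩
    m ^ (4 * b)              ≡⟨ sym (^-*-assoc m 4 b) ⟩
    (m ^ 4) ^ b              ≤⟨ ^-monoˡ-≤ b quartic ⟩
    (K * (n ^ 6 * E)) ^ b    ≡⟨ cong (_^ b) (*-comm-middle K (n ^ 6) E) ⟩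
    (n ^ 6 * (K * E)) ^ b    ≡⟨ ^-distribʳ-* (n ^ 6) (K * E) b ⟩
    (n ^ 6) ^ b * (K * E) ^ b ≡⟨ cong (_* (K * E) ^ b) (^-*-assoc n 6 b) ⟩
    n ^ (6 * b) * (K * E) ^ b ∎)
    where
    open ≤-Reasoning
    instance
      n≢0 : NonZero n
      n≢0 = >-nonZero (≤-trans (s≤s z≤n) 2≤n)
    *-comm-middle : ∀ k x e → k * (x * e) ≡ x * (k * e)
    *-comm-middle = solve-∀
  powers< : (c * K * E) ^ b < (d * K * E) ^ b
  powers< = <-≤-trans below (begin
    d ^ b * n ^ a            ≤⟨ *-monoʳ-≤ (d ^ b) n^a≤ ⟩
    d ^ b * (K * E) ^ b      ≡⟨ sym (^-distribʳ-* d (K * E) b) ⟩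
    (d * (K * E)) ^ b        ≡⟨ cong (_^ b) (sym (*-assoc d K E)) ⟩
    (d * K * E) ^ b          ∎)
    where open ≤-Reasoning
  c<d : c < d
  c<d = *-cancelʳ-< K c d (*-cancelʳ-< E (c * K) (d * K) (^-cancelˡ-< b powers<))

-- The counting bound for a dense duplicate-free S: m ≥ 32n² lies in a dyadic window
-- 32Tn² ≤ m < 64Tn², where m⁴ ≤ 2²⁰n⁶·E; stated for any constant K ≥ 2²⁰.
quartic-bound : ∀ n (S : List (Point n)) → Unique S → 1 ≤ n → 32 * (n * n) ≤ length S →
  ∀ K → 1048576 ≤ K → length S ^ 4 ≤ K * (n ^ 6 * spanned S)
quartic-bound n S unique 1≤n dense K 2²⁰≤K = begin
  m ^ 4                                             ≡⟨ fourth m ⟩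
  m * m * m * m                                     ≤⟨ Counting.fourth-power-bound n (proj₁ window) S unique
                                                          (proj₁ (proj₂ window)) (proj₂ (proj₂ window)) ⟩
  1048576 * (n * n * (n * n) * (n * n)) * spanned S ≤⟨ enlarge 1048576 K n (spanned S) 2²⁰≤K ⟩
  K * (n ^ 6 * spanned S)                           ∎
  where
  open ≤-Reasoning
  m : ℕ
  m = length S
  window : ∃[ j ] (32 * 2 ^ j * (n * n) ≤ m × m < 64 * 2 ^ j * (n * n))
  window = dyadic-window (n * n) m (*-mono-≤ 1≤n 1≤n) dense
  -- m ^ 4 unfolds to m * (m * (m * (m * 1)))
  fourth : ∀ m → m * (m * (m * (m * 1))) ≡ m * m * m * m
  fourth = solve-∀
  -- stated for a variable constant k, so that the literal 2²⁰ is never unfolded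
  enlarge : ∀ k K n e → k ≤ K → k * (n * n * (n * n) * (n * n)) * e ≤ K * (n ^ 6 * e)
  enlarge k K n e k≤K = ≤-trans (≤-reflexive (sixth k n e)) (*-monoˡ-≤ (n ^ 6 * e) k≤K)
    where
    sixth : ∀ k n e → k * (n * n * (n * n) * (n * n)) * e ≡ k * ((n * (n * (n * (n * (n * (n * 1)))))) * e)
    sixth = solve-∀

2²⁰≤C : 1048576 ≤ C
2²⁰≤C = ≤ᵇ⇒≤ 1048576 C _

-- Take N = 32^q where s < p/q < 1: then m ≥ n^(3q−p)/q gives m ≥ 32n², the counting bound
-- gives m⁴ ≤ C·n⁶·E, and edgeBound-from turns this into the stated edge bound.
lemma4p2 : (s : ℝ) → ¬ (s <ʳ 0ℚ) → s <ʳ 1ℚ →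
  ∃[ N ] (∀ (n : ℕ) → N ≤ n →
    ∀ (S : List (Point n)) → Unique S →
    AtLeastPow3 n s (length S) →
    EdgeBound n s (spanned S))
lemma4p2 s s≮0 s<1 with exponent-below-one s s≮0 s<1
... | p , d , p<q , s<p/q = 32 ^ suc d , bound
  where
  bound : ∀ n → 32 ^ suc d ≤ n → ∀ S → Unique S → AtLeastPow3 n s (length S) → EdgeBound n s (spanned S)
  bound n 32^q≤n S unique m≥ =
    edgeBound-from n s (length S) (spanned S) C 2≤n m≥ (quartic-bound n S unique (≤-trans (s≤s z≤n) 2≤n) dense C 2²⁰≤C)
    where
    2≤n : 2 ≤ n
    2≤n = ≤-trans (s≤s (s≤s z≤n)) (≤-trans (^-monoʳ-≤ 32 {1} {suc d} (s≤s z≤n)) 32^q≤n)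
    dense : 32 * (n * n) ≤ length S
    dense = dense-from-power n (length S) p (suc d) p<q 32^q≤n (m≥ (3 * suc d ∸ p) d s<p/q)
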